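{- Let $k, d \in \mathbb{N}$ with $k > d$. Let $I(k,d)$ be the minimal size of a subset $A \subseteq \mathbb{Z}_k$ such that for every $i \in \mathbb{Z}_k$, $A \not\subseteq \{i, i+1, \dots, i+d-1\}$. Then $I(k,d) = \left\lceil \frac{k}{k-d} \right\rceil$.
   Context: Addition in $\{i,i+1,\dots,i+d-1\}$ is taken in the group $\mathbb{Z}_k$, so these sets are the cyclic subintervals of $\mathbb{Z}_k$ of size $d$. -}

module Defs where

open import Data.Nat using (ℕ; zero; suc; _+_; _∸_; _<_; _≤_; NonZero; ≢-nonZero)
open import Data.Nat.DivMod using (_%_; _/_)
open import Data.Fin using (Fin; toℕ)
open import Data.Fin.Subset using (Subset; _⊆_; ∣_∣; _∈_)
open import Data.Vec.Functional using ()
open import Data.Vec using (tabulate)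
open import Data.Bool using (Bool)
open import Relation.Nullary using (¬_; Dec; does)
open import Data.Product using (Σ; _×_)
open import Relation.Binary.PropositionalEquality using (_≡_)
import Data.Nat.Properties as ℕP

-- residue of j - i in Z_k, represented in {0,...,k-1}
diffMod : {k : ℕ} → Fin k → Fin k → ℕ
diffMod {zero} ()
diffMod {suc k} i j = (toℕ j + (suc k ∸ toℕ i)) % suc k

-- the cyclic interval {i, i+1, ..., i+d-1} ⊆ Z_k, as a subset of Fin k
-- (j belongs to it iff (j - i) mod k < d)
cycInterval : (k d : ℕ) → Fin k → Subset k
cycInterval k d i = tabulate (λ j → does (diffMod i j ℕP.<? d))

NotInAnyInterval : (k d : ℕ) → Subset k → Set
NotInAnyInterval k d A = (i : Fin k) → ¬ (A ⊆ cycInterval k d i)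

IsMinSize : (k d m : ℕ) → Set
IsMinSize k d m =
  Σ (Subset k) (λ A → NotInAnyInterval k d A × ∣ A ∣ ≡ m)
  × ((A : Subset k) → NotInAnyInterval k d A → m ≤ ∣ A ∣)

ceilDiv : (a b : ℕ) → .{{NonZero b}} → ℕ
ceilDiv a b = (a + b ∸ 1) / b

ceilFrac : (k d : ℕ) → d < k → ℕ
ceilFrac k d d<k = ceilDiv k (k ∸ d) {{≢-nonZero (ℕP.m>n⇒m∸n≢0 d<k)}}

-- A set A meets the complement of every cyclic interval of length d exactly when every
-- i ∈ ℤ_k has some j ∈ A with (j − i) mod k ≥ d.  Choosing such a j for each i and recording
-- the excess (j − i) mod k − d < k − d gives an injection ℤ_k → A × Fin (k − d), since i is
-- recovered from j and (j − i) mod k; hence k ≤ |A| (k − d).  Conversely the multiples of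
-- k − d below k form such a set: cyclically consecutive ones, including the wrap-around
-- pair, are at most k − d apart, and there are ⌈k / (k − d)⌉ of them.
module Submission where

open import Defs
open import Data.Nat
  using (ℕ; zero; suc; _+_; _*_; _∸_; _≤_; _<_; _≤?_; _<?_; z≤n; s≤s; s≤s⁻¹; NonZero; ≢-nonZero)
open import Data.Nat.Properties hiding (suc-injective)
open import Algebra.Properties.CommutativeSemigroup +-commutativeSemigroup
  using (x∙yz≈y∙xz; xy∙z≈xz∙y; xy∙z≈y∙xz)
open import Data.Nat.DivMod
open import Data.Nat.Divisibility using (divides; _∣?_)
open import Data.Fin using (Fin; toℕ; fromℕ<; combine) renaming (zero to fzero; suc to fsuc)
open import Data.Fin.Properties
  using (toℕ<n; toℕ-fromℕ<; toℕ-injective; suc-injective; injective⇒≤; combine-injective; any?)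
open import Data.Fin.Subset using (Subset; ∣_∣; _∈_; _⊆_; inside; outside)
open import Data.Fin.Subset.Properties using (_∈?_)
open import Data.Vec using (_∷_; tabulate; here; there)
open import Data.Vec.Properties using (lookup∘tabulate; lookup⇒[]=; []=⇒lookup)
open import Data.Product using (∃; _×_; _,_; proj₁; proj₂)
open import Data.Empty using (⊥-elim)
open import Function using (_∘_)
open import Relation.Nullary using (Dec; yes; no; does; contradiction)
open import Relation.Nullary.Decidable using (_×-dec_)
open import Relation.Binary.PropositionalEquality

module _ {k} {P : Fin k → Set} (P? : ∀ x → Dec (P x)) where

  ∈-tabulate-does⁻ : ∀ {x} → x ∈ tabulate (does ∘ P?) → P x
  ∈-tabulate-does⁻ {x} x∈ with P? x | trans (sym (lookup∘tabulate (does ∘ P?) x)) ([]=⇒lookup x∈)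
  ... | yes Px | _  = Px
  ... | no _   | ()

  ∈-tabulate-does⁺ : ∀ {x} → P x → x ∈ tabulate (does ∘ P?)
  ∈-tabulate-does⁺ {x} Px = lookup⇒[]= x _ (trans (lookup∘tabulate (does ∘ P?) x) (does-yes (P? x)))
    where
    does-yes : (x? : Dec (P x)) → does x? ≡ inside
    does-yes (yes _)  = refl
    does-yes (no ¬Px) = contradiction Px ¬Px

enum : ∀ {k} (p : Subset k) → Fin ∣ p ∣ → Fin k
enum (outside ∷ p) x       = fsuc (enum p x)
enum (inside ∷ p) fzero    = fzero
enum (inside ∷ p) (fsuc x) = fsuc (enum p x)

enum-∈ : ∀ {k} (p : Subset k) (x : Fin ∣ p ∣) → enum p x ∈ p
enum-∈ (outside ∷ p) x       = there (enum-∈ p x)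
enum-∈ (inside ∷ p) fzero    = here
enum-∈ (inside ∷ p) (fsuc x) = there (enum-∈ p x)

enum-injective : ∀ {k} (p : Subset k) {x y : Fin ∣ p ∣} → enum p x ≡ enum p y → x ≡ y
enum-injective (outside ∷ p) eq = enum-injective p (suc-injective eq)
enum-injective (inside ∷ p) {fzero}  {fzero}  _  = refl
enum-injective (inside ∷ p) {fsuc x} {fsuc y} eq = cong fsuc (enum-injective p (suc-injective eq))

index : ∀ {k} {p : Subset k} {x} → x ∈ p → Fin ∣ p ∣
index {p = inside ∷ p}  here      = fzero
index {p = inside ∷ p}  (there h) = fsuc (index h)
index {p = outside ∷ p} (there h) = index h

enum-index : ∀ {k} {p : Subset k} {x} (x∈p : x ∈ p) → enum p (index x∈p) ≡ x
enum-index {p = inside ∷ p}  here      = refl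
enum-index {p = inside ∷ p}  (there h) = cong fsuc (enum-index h)
enum-index {p = outside ∷ p} (there h) = cong fsuc (enum-index h)

index-injective : ∀ {k} {p : Subset k} {x y} (x∈p : x ∈ p) (y∈p : y ∈ p) →
                  index x∈p ≡ index y∈p → x ≡ y
index-injective x∈p y∈p eq = trans (sym (enum-index x∈p)) (trans (cong (enum _) eq) (enum-index y∈p))

injectiveOn⇒∣p∣≤ : ∀ {k c} {p : Subset k} (g : Fin k → Fin c) →
                   (∀ {x y} → x ∈ p → y ∈ p → g x ≡ g y → x ≡ y) → ∣ p ∣ ≤ c
injectiveOn⇒∣p∣≤ {p = p} g inj =
  injective⇒≤ {f = g ∘ enum p} (enum-injective p ∘ inj (enum-∈ p _) (enum-∈ p _))

injective-pair⇒≤∣p∣* : ∀ {n k m} {p : Subset k} (f : Fin n → Fin k) (f∈p : ∀ x → f x ∈ p)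
                       (g : Fin n → Fin m) → (∀ {x y} → f x ≡ f y → g x ≡ g y → x ≡ y) →
                       n ≤ ∣ p ∣ * m
injective-pair⇒≤∣p∣* f f∈p g inj = injective⇒≤ {f = λ x → combine (index (f∈p x)) (g x)} λ eq →
  let index≡ , g≡ = combine-injective _ _ _ _ eq in inj (index-injective (f∈p _) (f∈p _) index≡) g≡

[m%n+o]%n≡[m+o]%n : ∀ m o n .{{_ : NonZero n}} → (m % n + o) % n ≡ (m + o) % n
[m%n+o]%n≡[m+o]%n m o n = begin
  (m % n + o) % n          ≡⟨ %-distribˡ-+ (m % n) o n ⟩
  (m % n % n + o % n) % n  ≡⟨ cong (λ x → (x + o % n) % n) (m%n%n≡m%n m n) ⟩
  (m % n + o % n) % n      ≡⟨ %-distribˡ-+ m o n ⟨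
  (m + o) % n              ∎
  where open ≡-Reasoning

[m+o%n]%n≡[m+o]%n : ∀ m o n .{{_ : NonZero n}} → (m + o % n) % n ≡ (m + o) % n
[m+o%n]%n≡[m+o]%n m o n = begin
  (m + o % n) % n  ≡⟨ cong (_% n) (+-comm m (o % n)) ⟩
  (o % n + m) % n  ≡⟨ [m%n+o]%n≡[m+o]%n o m n ⟩
  (o + m) % n      ≡⟨ cong (_% n) (+-comm o m) ⟩
  (m + o) % n      ∎
  where open ≡-Reasoning

[[m+o]%n+[n∸m]]%n≡o : ∀ m o n .{{_ : NonZero n}} → m ≤ n → o < n → ((m + o) % n + (n ∸ m)) % n ≡ o
[[m+o]%n+[n∸m]]%n≡o m o n m≤n o<n = begin
  ((m + o) % n + (n ∸ m)) % n  ≡⟨ [m%n+o]%n≡[m+o]%n (m + o) (n ∸ m) n ⟩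
  (m + o + (n ∸ m)) % n        ≡⟨ cong (_% n) (xy∙z≈y∙xz m o (n ∸ m)) ⟩
  (o + (m + (n ∸ m))) % n      ≡⟨ cong (λ x → (o + x) % n) (m+[n∸m]≡n m≤n) ⟩
  (o + n) % n                  ≡⟨ [m+n]%n≡m%n o n ⟩
  o % n                        ≡⟨ m<n⇒m%n≡m o<n ⟩
  o                            ∎
  where open ≡-Reasoning

module _ {n : ℕ} where

  private
    k : ℕ
    k = suc n

  diffMod<k : (i j : Fin k) → diffMod i j < k
  diffMod<k i j = m%n<n (toℕ j + (k ∸ toℕ i)) k

  [i+diffMod]%k≡j : (i j : Fin k) → (toℕ i + diffMod i j) % k ≡ toℕ j
  [i+diffMod]%k≡j i j = begin
    (toℕ i + (toℕ j + (k ∸ toℕ i)) % k) % k  ≡⟨ [m+o%n]%n≡[m+o]%n (toℕ i) _ k ⟩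
    (toℕ i + (toℕ j + (k ∸ toℕ i))) % k      ≡⟨ cong (_% k) (x∙yz≈y∙xz (toℕ i) (toℕ j) _) ⟩
    (toℕ j + (toℕ i + (k ∸ toℕ i))) % k      ≡⟨ cong (λ x → (toℕ j + x) % k) (m+[n∸m]≡n (<⇒≤ (toℕ<n i))) ⟩
    (toℕ j + k) % k                          ≡⟨ [m+n]%n≡m%n (toℕ j) k ⟩
    toℕ j % k                                ≡⟨ m<n⇒m%n≡m (toℕ<n j) ⟩
    toℕ j                                    ∎
    where open ≡-Reasoning

  diffMod-unique : ∀ {i j : Fin k} {t} → t < k → (toℕ i + t) % k ≡ toℕ j → diffMod i j ≡ t
  diffMod-unique {i} {j} {t} t<k [i+t]%k≡j = begin
    (toℕ j + (k ∸ toℕ i)) % k            ≡⟨ cong (λ x → (x + (k ∸ toℕ i)) % k) [i+t]%k≡j ⟨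
    ((toℕ i + t) % k + (k ∸ toℕ i)) % k  ≡⟨ [[m+o]%n+[n∸m]]%n≡o (toℕ i) t k (<⇒≤ (toℕ<n i)) t<k ⟩
    t                                    ∎
    where open ≡-Reasoning

  i≡[j+[k∸diffMod]]%k : (i j : Fin k) → toℕ i ≡ (toℕ j + (k ∸ diffMod i j)) % k
  i≡[j+[k∸diffMod]]%k i j = begin
    toℕ i                              ≡⟨ [[m+o]%n+[n∸m]]%n≡o D (toℕ i) k (<⇒≤ (diffMod<k i j)) (toℕ<n i) ⟨
    ((D + toℕ i) % k + (k ∸ D)) % k    ≡⟨ cong (λ x → (x % k + (k ∸ D)) % k) (+-comm D (toℕ i)) ⟩
    ((toℕ i + D) % k + (k ∸ D)) % k    ≡⟨ cong (λ x → (x + (k ∸ D)) % k) ([i+diffMod]%k≡j i j) ⟩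
    (toℕ j + (k ∸ D)) % k              ∎
    where
    open ≡-Reasoning
    D = diffMod i j

  diffMod-injectiveˡ : ∀ {i i′ j : Fin k} → diffMod i j ≡ diffMod i′ j → i ≡ i′
  diffMod-injectiveˡ {i} {i′} {j} eq = toℕ-injective (begin
    toℕ i                                ≡⟨ i≡[j+[k∸diffMod]]%k i j ⟩
    (toℕ j + (k ∸ diffMod i j)) % k      ≡⟨ cong (λ x → (toℕ j + (k ∸ x)) % k) eq ⟩
    (toℕ j + (k ∸ diffMod i′ j)) % k     ≡⟨ i≡[j+[k∸diffMod]]%k i′ j ⟨
    toℕ i′                               ∎)
    where open ≡-Reasoning

∈-cycInterval⁻ : ∀ {k d} {i j : Fin k} → j ∈ cycInterval k d i → diffMod i j < d
∈-cycInterval⁻ {d = d} {i} = ∈-tabulate-does⁻ (λ j → diffMod i j <? d)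

∈-cycInterval⁺ : ∀ {k d} {i j : Fin k} → diffMod i j < d → j ∈ cycInterval k d i
∈-cycInterval⁺ {d = d} {i} = ∈-tabulate-does⁺ (λ j → diffMod i j <? d)

Escapes : (k d : ℕ) → Subset k → Fin k → Set
Escapes k d A i = ∃ λ j → j ∈ A × d ≤ diffMod i j

notInAnyInterval⇒escapes : ∀ {k d} {A : Subset k} → NotInAnyInterval k d A → ∀ i → Escapes k d A i
notInAnyInterval⇒escapes {d = d} {A} notIn i with any? (λ j → (j ∈? A) ×-dec (d ≤? diffMod i j))
... | yes escape = escape
... | no ¬escape = ⊥-elim (notIn i A⊆interval)
  where
  A⊆interval : A ⊆ cycInterval _ d i
  A⊆interval {j} j∈A = ∈-cycInterval⁺ (≰⇒> (λ d≤ → ¬escape (j , j∈A , d≤)))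

escapes⇒notInAnyInterval : ∀ {k d} {A : Subset k} → (∀ i → Escapes k d A i) → NotInAnyInterval k d A
escapes⇒notInAnyInterval escapes i A⊆interval =
  let j , j∈A , d≤ = escapes i in <⇒≱ (∈-cycInterval⁻ (A⊆interval j∈A)) d≤

notInAnyInterval⇒k≤∣A∣*[k∸d] : ∀ {k d} {A : Subset k} → NotInAnyInterval k d A → k ≤ ∣ A ∣ * (k ∸ d)
notInAnyInterval⇒k≤∣A∣*[k∸d] {zero}      _     = z≤n
notInAnyInterval⇒k≤∣A∣*[k∸d] {suc n} {d} notIn =
  injective-pair⇒≤∣p∣* point (proj₁ ∘ proj₂ ∘ escape) excess excess-injective
  where
  escape : ∀ i → Escapes (suc n) d _ i
  escape = notInAnyInterval⇒escapes notIn

  point : Fin (suc n) → Fin (suc n)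
  point = proj₁ ∘ escape

  d≤diffMod : ∀ i → d ≤ diffMod i (point i)
  d≤diffMod = proj₂ ∘ proj₂ ∘ escape

  excess : Fin (suc n) → Fin (suc n ∸ d)
  excess i = fromℕ< (∸-monoˡ-< (diffMod<k i (point i)) (d≤diffMod i))

  excess-injective : ∀ {i i′} → point i ≡ point i′ → excess i ≡ excess i′ → i ≡ i′
  excess-injective {i} {i′} point≡ excess≡ = diffMod-injectiveˡ {j = point i} (begin
    diffMod i (point i)     ≡⟨ ∸-cancelʳ-≡ (d≤diffMod i) (d≤diffMod i′) diffMod∸d≡ ⟩
    diffMod i′ (point i′)   ≡⟨ cong (diffMod i′) point≡ ⟨
    diffMod i′ (point i)    ∎)
    where
    open ≡-Reasoning
    diffMod∸d≡ : diffMod i (point i) ∸ d ≡ diffMod i′ (point i′) ∸ d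
    diffMod∸d≡ = trans (sym (toℕ-fromℕ< _)) (trans (cong toℕ excess≡) (toℕ-fromℕ< _))

multiples : ∀ {k} → ℕ → Subset k
multiples m = tabulate (λ j → does (m ∣? toℕ j))

∣multiples∣≤ : ∀ {n} m .{{_ : NonZero m}} → ∣ multiples {suc n} m ∣ ≤ suc (n / m)
∣multiples∣≤ {n} m = injectiveOn⇒∣p∣≤ quotient quotient-injective
  where
  quotient : Fin (suc n) → Fin (suc (n / m))
  quotient j = fromℕ< (s≤s (/-monoˡ-≤ m (s≤s⁻¹ (toℕ<n j))))

  quotient-injective : ∀ {x y} → x ∈ multiples m → y ∈ multiples m → quotient x ≡ quotient y → x ≡ y
  quotient-injective {x} {y} x∈ y∈ eq = toℕ-injective (begin
    toℕ x          ≡⟨ m/n*n≡m (∈-tabulate-does⁻ (λ j → m ∣? toℕ j) x∈) ⟨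
    toℕ x / m * m  ≡⟨ cong (_* m) (trans (sym (toℕ-fromℕ< _)) (trans (cong toℕ eq) (toℕ-fromℕ< _))) ⟩
    toℕ y / m * m  ≡⟨ m/n*n≡m (∈-tabulate-does⁻ (λ j → m ∣? toℕ j) y∈) ⟩
    toℕ y          ∎)
    where open ≡-Reasoning

m<[m/n]*n+n : ∀ m n .{{_ : NonZero n}} → m < m / n * n + n
m<[m/n]*n+n m n = begin-strict
  m                  ≡⟨ m≡m%n+[m/n]*n m n ⟩
  m % n + m / n * n  <⟨ +-monoˡ-< (m / n * n) (m%n<n m n) ⟩
  n + m / n * n      ≡⟨ +-comm n (m / n * n) ⟩
  m / n * n + n      ∎
  where open ≤-Reasoning

module _ {n d : ℕ} (d<k : d < suc n) where

  private
    k m : ℕ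
    k = suc n
    m = k ∸ d

    instance
      m-nonZero : NonZero m
      m-nonZero = ≢-nonZero (m>n⇒m∸n≢0 d<k)

    d+m≡k : d + m ≡ k
    d+m≡k = m+[n∸m]≡n (<⇒≤ d<k)

  -- The hypothesis says r ≡ i − 1 (mod k); the escaping point is the largest multiple of m
  -- not exceeding r.
  multiples-escape-below : ∀ (i : Fin k) r → r ≤ n → (toℕ i + (n ∸ r)) % k ≡ 0 → Escapes k d (multiples m) i
  multiples-escape-below i r r≤n [i+[n∸r]]%k≡0 = j , j∈multiples , d≤diffMod
    where
    a t : ℕ
    a = r / m * m
    t = a + (n ∸ r)

    a<k : a < k
    a<k = s≤s (≤-trans (m/n*n≤m r m) r≤n)

    j : Fin k
    j = fromℕ< a<k

    j∈multiples : j ∈ multiples m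
    j∈multiples = ∈-tabulate-does⁺ (λ x → m ∣? toℕ x) (divides (r / m) (toℕ-fromℕ< a<k))

    t<k : t < k
    t<k = s≤s (begin
      a + (n ∸ r)  ≤⟨ +-monoˡ-≤ (n ∸ r) (m/n*n≤m r m) ⟩
      r + (n ∸ r)  ≡⟨ m+[n∸m]≡n r≤n ⟩
      n            ∎)
      where open ≤-Reasoning

    [i+t]%k≡j : (toℕ i + t) % k ≡ toℕ j
    [i+t]%k≡j = begin
      (toℕ i + (a + (n ∸ r))) % k      ≡⟨ cong (_% k) (x∙yz≈y∙xz (toℕ i) a (n ∸ r)) ⟩
      (a + (toℕ i + (n ∸ r))) % k      ≡⟨ [m+o%n]%n≡[m+o]%n a _ k ⟨
      (a + (toℕ i + (n ∸ r)) % k) % k  ≡⟨ cong (λ x → (a + x) % k) [i+[n∸r]]%k≡0 ⟩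
      (a + 0) % k                      ≡⟨ cong (_% k) (+-identityʳ a) ⟩
      a % k                            ≡⟨ m<n⇒m%n≡m a<k ⟩
      a                                ≡⟨ toℕ-fromℕ< a<k ⟨
      toℕ j                            ∎
      where open ≡-Reasoning

    d≤t : d ≤ t
    d≤t = +-cancelʳ-≤ m d t (begin
      d + m              ≡⟨ d+m≡k ⟩
      suc n              ≡⟨ cong suc (m+[n∸m]≡n r≤n) ⟨
      suc r + (n ∸ r)    ≤⟨ +-monoˡ-≤ (n ∸ r) (m<[m/n]*n+n r m) ⟩
      a + m + (n ∸ r)    ≡⟨ xy∙z≈xz∙y a m (n ∸ r) ⟩
      a + (n ∸ r) + m    ∎)
      where open ≤-Reasoning

    d≤diffMod : d ≤ diffMod i j
    d≤diffMod = subst (d ≤_) (sym (diffMod-unique {i = i} t<k [i+t]%k≡j)) d≤t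

  multiples-notInAnyInterval : NotInAnyInterval k d (multiples m)
  multiples-notInAnyInterval = escapes⇒notInAnyInterval escape
    where
    escape : ∀ i → Escapes k d (multiples m) i
    escape fzero    = multiples-escape-below fzero n ≤-refl (cong (_% k) (n∸n≡0 n))
    escape (fsuc x) = multiples-escape-below (fsuc x) (toℕ x) (<⇒≤ (toℕ<n x))
                        (trans (cong (λ y → suc y % k) (m+[n∸m]≡n (<⇒≤ (toℕ<n x)))) (n%n≡0 k))

ceilDiv[1+n]≡1+n/m : ∀ n m .{{_ : NonZero m}} → ceilDiv (suc n) m ≡ suc (n / m)
ceilDiv[1+n]≡1+n/m n m = trans (m/n≡1+[m∸n]/n (m≤n+m m n)) (cong suc (/-congˡ (m+n∸n≡m n m)))

mainTheorem9 : (k d : ℕ) → (d<k : d < k) → IsMinSize k d (ceilFrac k d d<k)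
mainTheorem9 zero    d ()
mainTheorem9 (suc n) d d<k =
  (multiples m , multiples-notInAnyInterval d<k , ≤-antisym ∣multiples∣≤ceil (ceil≤ _ (multiples-notInAnyInterval d<k))) ,
  ceil≤
  where
  m : ℕ
  m = suc n ∸ d

  instance
    m-nonZero : NonZero m
    m-nonZero = ≢-nonZero (m>n⇒m∸n≢0 d<k)

  ceil≡ : ceilFrac (suc n) d d<k ≡ suc (n / m)
  ceil≡ = ceilDiv[1+n]≡1+n/m n m

  ∣multiples∣≤ceil : ∣ multiples {suc n} m ∣ ≤ ceilFrac (suc n) d d<k
  ∣multiples∣≤ceil = subst (∣ multiples {suc n} m ∣ ≤_) (sym ceil≡) (∣multiples∣≤ m)

  ceil≤ : (A : Subset (suc n)) → NotInAnyInterval (suc n) d A → ceilFrac (suc n) d d<k ≤ ∣ A ∣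
  ceil≤ A notIn = subst (_≤ ∣ A ∣) (sym ceil≡) (m<n*o⇒m/o<n (notInAnyInterval⇒k≤∣A∣*[k∸d] {d = d} notIn))
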